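{- If $D_{15,14,6}$ is unsatisfiable, i.e., there is no packing $14$-coloring $f$ of $D_{15}$ with $f((0,0))=6$, then $\chi_\rho(\mathbb{Z}^2)\geq 15$.
   Context: Let $\mathbb{Z}^2$ denote the infinite graph with vertex set $\mathbb{Z}\times\mathbb{Z}$ in which two vertices are adjacent iff their $\ell_1$ distance equals $1$; write $d(u,v)$ for the graph distance. For a simple undirected graph $G=(V,E)$, a packing $k$-coloring is a function $f: V \to \{1,\dots,k\}$ such that for any two distinct vertices $u,v\in V$ and any color $c$, $f(u)=f(v)=c$ implies $d(u,v)>c$; here distances in a subgraph are those of $\mathbb{Z}^2$ restricted to it (equivalently, the $\ell_1$ distance). The packing chromatic number $\chi_\rho(G)$ is the minimum $k$ such that $G$ admits a packing $k$-coloring. For $r\ge 0$, $D_r$ denotes the subgraph of $\mathbb{Z}^2$ induced by $\{u\in\mathbb{Z}^2 : d(u,(0,0))\le r\}$. The instance $D_{r,k,c}$ is the question of whether $D_r$ admits a packing $k$-coloring assigning color $c$ to the vertex $(0,0)$; it is called unsatisfiable if no such coloring exists. -}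

module Defs where

open import Data.Nat using (ℕ; _≤_; _<_)
open import Data.Integer as ℤ using (ℤ; ∣_∣; _-_)
open import Data.Product using (Σ; _×_; _,_; proj₁)
open import Relation.Binary.PropositionalEquality using (_≡_)
open import Relation.Nullary using (¬_)

Point : Set
Point = ℤ × ℤ

-- Graph distance in Z² (= ℓ1 distance)
dist : Point → Point → ℕ
dist (x₁ , y₁) (x₂ , y₂) = ∣ x₁ - x₂ ∣ Data.Nat.+ ∣ y₁ - y₂ ∣
  where import Data.Nat

origin : Point
origin = (ℤ.+ 0 , ℤ.+ 0)

-- Packing k-coloring of the subgraph of Z² induced by the vertex set {u | S u}
-- (distances are the ℓ1 distances of Z²). Colors are 1,…,k.
IsPackingColoring : (S : Point → Set) (k : ℕ) → (Σ Point S → ℕ) → Set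
IsPackingColoring S k f =
  ((v : Σ Point S) → 1 ≤ f v × f v ≤ k) ×
  ((u v : Σ Point S) → ¬ (proj₁ u ≡ proj₁ v) → f u ≡ f v → f u < dist (proj₁ u) (proj₁ v))

All : Point → Set
All _ = ⊤
  where open import Data.Unit using (⊤)

InD : ℕ → Point → Set
InD r u = dist u origin ≤ r

Z²Colorable : ℕ → Set
Z²Colorable k = Σ (Σ Point All → ℕ) (IsPackingColoring All k)

D-instance-sat : ℕ → ℕ → ℕ → Set
D-instance-sat r k c =
  Σ (Σ Point (InD r) → ℕ) λ f →
    IsPackingColoring (InD r) k f ×
    ((h : InD r origin) → f (origin , h) ≡ c)

-- Packing colorings of Z² are invariant under translation, so if some vertex has color 6 we
-- translate it to the origin and restrict to D₁₅. If no vertex within distance 6 of the origin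
-- has color 6, recoloring the origin with 6 keeps the coloring a packing coloring. Either way a
-- packing 14-coloring of Z² would yield a solution of D_{15,14,6}.
module Submission where

open import Defs
open import Data.Nat as ℕ using (ℕ; _≤_; _<_; s≤s; z≤n; _≤?_)
import Data.Nat.Properties as ℕ
open import Data.Integer as ℤ using (ℤ; +_; ∣_∣; _-_)
import Data.Integer.Properties as ℤ
open import Data.Integer.Tactic.RingSolver using (solve-∀)
open import Algebra.Properties.AbelianGroup ℤ.+-0-abelianGroup using (∙-cancelʳ)
open import Data.Product using (Σ; ∃; _×_; _,_; proj₁; proj₂)
open import Data.Product.Properties using (≡-dec)
open import Data.Sum using (_⊎_; inj₁; inj₂; [_,_]′)
open import Data.Unit using (tt)
open import Function using (_∘_)
open import Data.Empty using (⊥-elim)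
open import Relation.Unary using (Pred; Decidable)
open import Relation.Binary.Definitions using (DecidableEquality)
open import Relation.Nullary using (¬_; Dec; yes; no; map′; _⊎-dec_)
open import Relation.Binary.PropositionalEquality

private
  variable
    k c : ℕ
    f : Σ Point All → ℕ

_≟ₚ_ : DecidableEquality Point
_≟ₚ_ = ≡-dec ℤ._≟_ ℤ._≟_

_⊕_ : Point → Point → Point
(a , b) ⊕ (c , d) = (a ℤ.+ c , b ℤ.+ d)

⊕-cancelʳ : ∀ p {u v} → u ⊕ p ≡ v ⊕ p → u ≡ v
⊕-cancelʳ (c , d) {a , b} {a′ , b′} eq =
  cong₂ _,_ (∙-cancelʳ c a a′ (cong proj₁ eq)) (∙-cancelʳ d b b′ (cong proj₂ eq))

origin-⊕ : ∀ p → origin ⊕ p ≡ p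
origin-⊕ (a , b) = cong₂ _,_ (ℤ.+-identityˡ a) (ℤ.+-identityˡ b)

dist-⊕ʳ : ∀ u v p → dist (u ⊕ p) (v ⊕ p) ≡ dist u v
dist-⊕ʳ (a , b) (a′ , b′) (c , d) = cong₂ ℕ._+_ (cong ∣_∣ (shift a a′ c)) (cong ∣_∣ (shift b b′ d))
  where
  shift : ∀ x y z → (x ℤ.+ z) - (y ℤ.+ z) ≡ x - y
  shift = solve-∀

dist-sym : ∀ u v → dist u v ≡ dist v u
dist-sym (a , b) (a′ , b′) = cong₂ ℕ._+_ (ℤ.∣i-j∣≡∣j-i∣ a a′) (ℤ.∣i-j∣≡∣j-i∣ b b′)

dist-origin : ∀ x y → dist (x , y) origin ≡ ∣ x ∣ ℕ.+ ∣ y ∣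
dist-origin x y = cong₂ ℕ._+_ (cong ∣_∣ (ℤ.+-identityʳ x)) (cong ∣_∣ (ℤ.+-identityʳ y))

module _ {p} {P : Pred ℤ p} (P? : Decidable P) where

  any-∣∣≤? : ∀ n → Dec (∃ λ z → ∣ z ∣ ≤ n × P z)
  any-∣∣≤? n = map′ to from (ℕ.anyUpTo? (λ m → P? (+ m) ⊎-dec P? (ℤ.- + m)) (ℕ.suc n))
    where
    to : ∃ (λ m → m < ℕ.suc n × (P (+ m) ⊎ P (ℤ.- + m))) → ∃ λ z → ∣ z ∣ ≤ n × P z
    to (m , s≤s m≤n , inj₁ Pm)  = + m , m≤n , Pm
    to (m , s≤s m≤n , inj₂ P-m) = ℤ.- + m , subst (_≤ n) (sym (ℤ.∣-i∣≡∣i∣ (+ m))) m≤n , P-m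

    from : (∃ λ z → ∣ z ∣ ≤ n × P z) → ∃ λ m → m < ℕ.suc n × (P (+ m) ⊎ P (ℤ.- + m))
    from (z , ∣z∣≤n , Pz) = ∣ z ∣ , s≤s ∣z∣≤n , [ positive , negative ]′ (ℤ.+∣i∣≡i⊎+∣i∣≡-i z)
      where
      positive : + ∣ z ∣ ≡ z → P (+ ∣ z ∣) ⊎ P (ℤ.- + ∣ z ∣)
      positive eq = inj₁ (subst P (sym eq) Pz)

      negative : + ∣ z ∣ ≡ ℤ.- z → P (+ ∣ z ∣) ⊎ P (ℤ.- + ∣ z ∣)
      negative eq = inj₂ (subst P (sym (trans (cong ℤ.-_ eq) (ℤ.neg-involutive z))) Pz)

any-box? : ∀ {p} {Q : Pred Point p} → Decidable Q → ∀ n →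
           Dec (∃ λ x → ∣ x ∣ ≤ n × ∃ λ y → ∣ y ∣ ≤ n × Q (x , y))
any-box? Q? n = any-∣∣≤? (λ x → any-∣∣≤? (λ y → Q? (x , y)) n) n

packing-mono : ∀ {S k k′ f} → k ≤ k′ → IsPackingColoring S k f → IsPackingColoring S k′ f
packing-mono k≤k′ (bounds , packed) =
  (λ v → proj₁ (bounds v) , ℕ.≤-trans (proj₂ (bounds v)) k≤k′) , packed

translate-packing : IsPackingColoring All k f → (S : Point → Set) (p : Point) →
                    IsPackingColoring S k (λ v → f (proj₁ v ⊕ p , tt))
translate-packing {f = f} (bounds , packed) S p =
  (λ v → bounds (proj₁ v ⊕ p , tt)) , packed′
  where
  packed′ : (u v : Σ Point S) → ¬ proj₁ u ≡ proj₁ v → f (proj₁ u ⊕ p , tt) ≡ f (proj₁ v ⊕ p , tt) →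
            f (proj₁ u ⊕ p , tt) < dist (proj₁ u) (proj₁ v)
  packed′ (u , _) (v , _) u≢v same =
    subst (f (u ⊕ p , tt) <_) (dist-⊕ʳ u v p)
          (packed (u ⊕ p , tt) (v ⊕ p , tt) (u≢v ∘ ⊕-cancelʳ p) same)

centred-instance : ∀ r → IsPackingColoring All k f → (p : Point) → f (p , tt) ≡ c →
                   D-instance-sat r k c
centred-instance {f = f} r packing p fp≡c =
  (λ v → f (proj₁ v ⊕ p , tt)) , translate-packing packing (InD r) p ,
  λ _ → trans (cong (λ q → f (q , tt)) (origin-⊕ p)) fp≡c

recolor : (Σ Point All → ℕ) → Point → ℕ → Σ Point All → ℕ
recolor f p c (u , t) with u ≟ₚ p
... | yes _ = c
... | no _  = f (u , t)

recolor-at : ∀ f p c → recolor f p c (p , tt) ≡ c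
recolor-at f p c with p ≟ₚ p
... | yes _  = refl
... | no p≢p = ⊥-elim (p≢p refl)

recolor-packing : IsPackingColoring All k f → 1 ≤ c → c ≤ k → (p : Point) →
                  (∀ u → ¬ u ≡ p → dist u p ≤ c → ¬ f (u , tt) ≡ c) →
                  IsPackingColoring All k (recolor f p c)
recolor-packing {k} {f} {c} (bounds , packed) 1≤c c≤k p avoid = bounds′ , packed′
  where
  far : ∀ u → ¬ u ≡ p → f (u , tt) ≡ c → c < dist u p
  far u u≢p fu≡c = ℕ.≰⇒> λ close → avoid u u≢p close fu≡c

  bounds′ : ∀ v → 1 ≤ recolor f p c v × recolor f p c v ≤ k
  bounds′ (u , t) with u ≟ₚ p
  ... | yes _ = 1≤c , c≤k
  ... | no _  = bounds (u , t)

  packed′ : ∀ u v → ¬ proj₁ u ≡ proj₁ v → recolor f p c u ≡ recolor f p c v →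
            recolor f p c u < dist (proj₁ u) (proj₁ v)
  packed′ (u , t) (v , s) u≢v same with u ≟ₚ p | v ≟ₚ p
  ... | yes refl | yes refl = ⊥-elim (u≢v refl)
  ... | yes refl | no v≢p   = subst (c <_) (dist-sym v p) (far v v≢p (sym same))
  ... | no u≢p   | yes refl = subst (_< dist u p) (sym same) (far u u≢p same)
  ... | no _     | no _     = packed (u , t) (v , s) u≢v same

Z²Colorable-mono : ∀ {k k′} → k ≤ k′ → Z²Colorable k → Z²Colorable k′
Z²Colorable-mono k≤k′ (f , packing) = f , packing-mono k≤k′ packing

-- Whether color c occurs anywhere in Z² is not decidable, so we only search the box
-- |x|, |y| ≤ c; it contains the ball of radius c that the recoloring must keep free of c.
Z²Colorable⇒D-instance-sat : ∀ r → 1 ≤ c → c ≤ k → Z²Colorable k → D-instance-sat r k c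
Z²Colorable⇒D-instance-sat {c} r 1≤c c≤k (f , packing)
  with any-box? (λ v → f (v , tt) ℕ.≟ c) c
... | yes (x , _ , y , _ , fxy≡c) = centred-instance r packing (x , y) fxy≡c
... | no no-c-near-origin =
  centred-instance r (recolor-packing packing 1≤c c≤k origin avoid) origin (recolor-at f origin c)
  where
  avoid : ∀ u → ¬ u ≡ origin → dist u origin ≤ c → ¬ f (u , tt) ≡ c
  avoid (x , y) _ close fxy≡c =
    no-c-near-origin (x , ℕ.≤-trans (ℕ.m≤m+n _ _) close′ , y , ℕ.≤-trans (ℕ.m≤n+m _ _) close′ , fxy≡c)
    where
    close′ : ∣ x ∣ ℕ.+ ∣ y ∣ ≤ c
    close′ = subst (_≤ c) (dist-origin x y) close

lemma2 : ¬ D-instance-sat 15 14 6 →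
    (k : ℕ) → Z²Colorable k → 15 ≤ k
lemma2 unsat k colorable with 15 ≤? k
... | yes 15≤k = 15≤k
... | no 15≰k  = ⊥-elim (unsat (Z²Colorable⇒D-instance-sat 15 (s≤s z≤n) (ℕ.m≤m+n 6 8) colorable₁₄))
  where
  colorable₁₄ : Z²Colorable 14
  colorable₁₄ = Z²Colorable-mono (ℕ.≤-pred (ℕ.≰⇒> 15≰k)) colorable
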